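{- Let $Q$ be an abundant acyclic quiver on $n$ vertices. Then the labelled mutation class of $Q$ contains exactly $n$ quivers that are not forks. Additionally, mutating $Q$ repeatedly at sources (or repeatedly at sinks) produces an $n$-cycle in the labelled mutation graph of $Q$.
   Context: A quiver is a finite directed multigraph with no loops and no 2-cycles; $q_{ij}$ is the number of arrows $i\to j$ if positive and minus the number of arrows $j\to i$ otherwise. Mutation $\mu_v$: $q'_{ab}=-q_{ab}$ if $v\in\{a,b\}$, else $q'_{ab}=q_{ab}+\max(q_{av},0)\max(q_{vb},0)-\max(q_{bv},0)\max(q_{va},0)$. The labelled mutation class $[Q]$ is the set of quivers on the same vertex set obtainable from $Q$ by mutations; the labelled mutation graph has vertex set $[Q]$ and an edge labelled $\mu_v$ between $P$ and $\mu_v(P)$. Abundant: at least two arrows between every pair of distinct vertices; acyclic: no directed cycle; a source (sink) is a vertex with only outgoing (incoming) arrows. $Q^+(v)=\{j:q_{vj}>0\}$, $Q^-(v)=\{j:q_{jv}>0\}$. A fork is an abundant, non-acyclic quiver $F$ with a vertex $r$ such that for all $i\in F^-(r)$, $j\in F^+(r)$: $f_{ji}>f_{ir}$ and $f_{ji}>f_{rj}$, and the full subquivers on $F^-(r)$ and $F^+(r)$ are acyclic. -}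

module Defs where

open import Data.Nat using (ℕ; zero; suc; _<ᵇ_)
open import Data.Integer using (ℤ; +_; _+_; _-_; _*_; -_; _⊔_; _<_; _>_; ∣_∣; 0ℤ)
import Data.Nat as ℕ
open import Data.Fin using (Fin; _≟_)
open import Data.Product using (Σ; ∃; _×_; _,_)
open import Data.Empty using (⊥)
open import Relation.Nullary using (¬_; yes; no)
open import Relation.Binary.PropositionalEquality using (_≡_; _≢_)
open import Relation.Binary.Construct.Closure.Transitive using (TransClosure)

-- A quiver on vertex set Fin n, given by its exchange matrix q i j
-- (number of arrows i → j if positive, minus number of arrows j → i otherwise).
Mat : ℕ → Set
Mat n = Fin n → Fin n → ℤ

-- skew-symmetry (the matrix of a quiver with no loops and no 2-cycles)
IsQuiver : ∀ {n} → Mat n → Set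
IsQuiver {n} q = ∀ (i j : Fin n) → q i j ≡ - q j i

_≈Q_ : ∀ {n} → Mat n → Mat n → Set
_≈Q_ {n} p q = ∀ (i j : Fin n) → p i j ≡ q i j

pos : ℤ → ℤ
pos x = x ⊔ 0ℤ

μ : ∀ {n} → Fin n → Mat n → Mat n
μ v q a b with v ≟ a | v ≟ b
... | yes _ | _     = - q a b
... | no _  | yes _ = - q a b
... | no _  | no _  = q a b + pos (q a v) * pos (q v b) - pos (q b v) * pos (q v a)

data InClass {n} (Q : Mat n) : Mat n → Set where
  here : InClass Q Q
  step : ∀ {P} (v : Fin n) → InClass Q P → InClass Q (μ v P)

Arrow : ∀ {n} → Mat n → Fin n → Fin n → Set
Arrow q i j = 0ℤ < q i j

Abundant : ∀ {n} → Mat n → Set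
Abundant {n} q = ∀ (i j : Fin n) → i ≢ j → 2 ℕ.≤ ∣ q i j ∣

AcyclicOn : ∀ {n} → Mat n → (Fin n → Set) → Set
AcyclicOn {n} q S =
  ¬ (Σ (Fin n) λ i → S i × TransClosure (λ a b → S a × S b × Arrow q a b) i i)

Acyclic : ∀ {n} → Mat n → Set
Acyclic {n} q = ¬ (Σ (Fin n) λ i → TransClosure (Arrow q) i i)

IsFork : ∀ {n} → Mat n → Set
IsFork {n} f =
  Abundant f × ¬ Acyclic f ×
  Σ (Fin n) λ r →
    (∀ (i j : Fin n) → Arrow f i r → Arrow f r j → (f j i > f i r) × (f j i > f r j))
    × AcyclicOn f (λ i → Arrow f i r)
    × AcyclicOn f (λ j → Arrow f r j)

IsSource : ∀ {n} → Mat n → Fin n → Set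
IsSource {n} q v = ∀ (j : Fin n) → ¬ Arrow q j v

IsSink : ∀ {n} → Mat n → Fin n → Set
IsSink {n} q v = ∀ (j : Fin n) → ¬ Arrow q v j

iter : ∀ {n} → Mat n → (ℕ → Fin n) → ℕ → Mat n
iter Q v zero    = Q
iter Q v (suc k) = μ (v k) (iter Q v k)

-- mutating repeatedly at vertices satisfying Good (source/sink) yields an
-- n-cycle Q₀ – Q₁ – … – Q_{n-1} – Q_n = Q₀ in the labelled mutation graph
NCycleVia : ∀ {n} → (Mat n → Fin n → Set) → Mat n → Set
NCycleVia {n} Good Q =
  (Σ (ℕ → Fin n) λ v → ∀ k → Good (iter Q v k) (v k))
  × (∀ (v : ℕ → Fin n) → (∀ k → Good (iter Q v k) (v k)) →
       (iter Q v n ≈Q Q)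
       × (∀ (k l : ℕ) → k ℕ.< n → l ℕ.< n → iter Q v k ≈Q iter Q v l → k ≡ l))

-- An abundant acyclic quiver is a transitive tournament, so it has a unique source and a
-- unique sink.  Mutating at the source reverses exactly the arrows at that vertex, giving
-- again an abundant acyclic quiver in which it has become the sink.  Repeated source
-- mutation therefore runs through the vertices in topological order, the k-th quiver being
-- Q with the arrows between the first k vertices and the others reversed, and after n steps
-- every arrow has been reversed twice: this is the n-cycle.  Sink mutation is source
-- mutation in the opposite quiver.
--
-- Mutating a quiver of the cycle at its source or sink gives a neighbour on the cycle;
-- mutating it at any other vertex k gives a fork with point of return k, and mutating a fork
-- with point of return r at k ≢ r gives one with point of return k (at r it undoes the previous
-- step).  In both cases the new weight F j i + F j k * F k i of an arrow j → i created by
-- the mutation dominates the weights of i → k and k → j.  Hence every quiver of the class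
-- is on the cycle or a fork, and forks are not acyclic.
module Submission where

open import Defs
open import Data.Nat using (ℕ; NonZero)
open import Data.Fin using (Fin)
open import Data.Product using (Σ; _×_)
open import Relation.Nullary using (¬_)
open import Relation.Binary.PropositionalEquality using (_≡_)

open import Data.Bool using (Bool; true; false; _∨_; _xor_)
import Data.Bool.Properties as BoolP
open import Data.Empty using (⊥; ⊥-elim)
open import Data.Fin using (_≟_; toℕ; fromℕ<) renaming (zero to fzero; suc to fsuc)
import Data.Fin.Properties as FinP
open import Data.Integer using (ℤ; +_; -[1+_]; +[1+_]; _+_; _-_; _*_; -_; _<_; _>_; _≤_; ∣_∣; 0ℤ; 1ℤ; +≤+; +<+)
import Data.Integer.Properties as ℤP
open import Data.Integer.Tactic.RingSolver using (solve-∀)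
open import Data.List using ([]; _∷_; allFin)
open import Data.List.Membership.Propositional using (_∈_)
open import Data.List.Membership.Propositional.Properties using (∈-allFin)
open import Data.List.Relation.Unary.Any using (here; there)
open import Data.Nat as ℕ using (zero; suc; z≤n; s≤s)
import Data.Nat.Properties as ℕP
open import Data.Product using (∃; _,_; proj₁; proj₂)
open import Data.Sum using (_⊎_; inj₁; inj₂)
open import Data.Unit using (⊤; tt)
open import Function using (_∘_; _∘′_)
open import Relation.Binary.Construct.Closure.Transitive using (TransClosure; [_]; _∷_; _∷ʳ_)
open import Relation.Binary.Definitions using (tri<; tri≈; tri>)
open import Relation.Binary.PropositionalEquality
open import Relation.Nullary using (Dec; yes; no; does; ¬?)

private variable
  n : ℕ
  a b c i j k : ℤ

-- Integer inequalities


<-by-positive-difference : ∀ d → b ≡ a + d → 0ℤ < d → a < b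
<-by-positive-difference {a = a} d refl 0<d =
  subst (_< a + d) (ℤP.+-identityʳ a) (ℤP.+-monoʳ-< a 0<d)

0≤i*j : 0ℤ ≤ i → 0ℤ ≤ j → 0ℤ ≤ i * j
0≤i*j {+ m} {+ n} _ _ = subst (0ℤ ≤_) (ℤP.pos-* m n) (+≤+ z≤n)

0<i*j : 0ℤ < i → 0ℤ < j → 0ℤ < i * j
0<i*j {+[1+ m ]} {+[1+ n ]} (+<+ _) (+<+ _) = subst (0ℤ <_) (ℤP.pos-* (ℕ.suc m) (ℕ.suc n)) (+<+ (s≤s z≤n))

0≤j-[1+i] : i < j → 0ℤ ≤ j - (i + 1ℤ)
0≤j-[1+i] {i} i<j = ℤP.i≤j⇒0≤j-i (subst (_≤ _) (ℤP.+-comm 1ℤ i) (ℤP.i<j⇒suc[i]≤j i<j))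

0<j-i : i < j → 0ℤ < j - i
0<j-i {i} {j} i<j = subst (0ℤ <_) (shift i j) (ℤP.+-mono-≤-< (0≤j-[1+i] i<j) (+<+ (s≤s z≤n)))
  where
  shift : ∀ i j → j - (i + 1ℤ) + 1ℤ ≡ j - i
  shift = solve-∀

i<k+i*j : 0ℤ < k → 0ℤ < i → 0ℤ < j → i < k + i * j
i<k+i*j {k} {i} {j} 0<k 0<i 0<j =
  <-by-positive-difference (k + i * (j - 1ℤ)) (split k i j)
    (ℤP.+-mono-<-≤ 0<k (0≤i*j (ℤP.<⇒≤ 0<i) (0≤j-[1+i] 0<j)))
  where
  split : ∀ k i j → k + i * j ≡ i + (k + i * (j - (0ℤ + 1ℤ)))
  split = solve-∀

j<k+i*j : 0ℤ < k → 0ℤ < i → 0ℤ < j → j < k + i * j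
j<k+i*j {k} {i} {j} 0<k 0<i 0<j =
  <-by-positive-difference (k + (i - 1ℤ) * j) (split k i j)
    (ℤP.+-mono-<-≤ 0<k (0≤i*j (0≤j-[1+i] 0<i) (ℤP.<⇒≤ 0<j)))
  where
  split : ∀ k i j → k + i * j ≡ j + (k + (i - (0ℤ + 1ℤ)) * j)
  split = solve-∀

i<-c+i*j : 0ℤ < c → + 2 ≤ i → c < j → i < - c + i * j
i<-c+i*j {c} {i} {j} 0<c 2≤i c<j =
  <-by-positive-difference (i * (j - (c + 1ℤ)) + (i - 1ℤ) * c) (split c i j)
    (ℤP.+-mono-≤-< (0≤i*j (ℤP.≤-trans (+≤+ z≤n) 2≤i) (0≤j-[1+i] c<j))
                   (0<i*j (0<j-i (ℤP.<-≤-trans (+<+ (s≤s (s≤s z≤n))) 2≤i)) 0<c))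
  where
  split : ∀ c i j → - c + i * j ≡ i + (i * (j - (c + 1ℤ)) + (i - 1ℤ) * c)
  split = solve-∀

j<-c+i*j : 0ℤ < c → + 2 ≤ i → c < j → j < - c + i * j
j<-c+i*j {c} {i} {j} 0<c 2≤i c<j =
  <-by-positive-difference ((i - + 2) * j + (j - (c + 1ℤ)) + 1ℤ) (split c i j)
    (ℤP.+-mono-≤-< (ℤP.+-mono-≤ (0≤i*j (ℤP.i≤j⇒0≤j-i 2≤i) (ℤP.<⇒≤ (ℤP.<-trans 0<c c<j)))
                                (0≤j-[1+i] c<j))
                   (+<+ (s≤s z≤n)))
  where
  split : ∀ c i j → - c + i * j ≡ j + ((i - + 2) * j + (j - (c + 1ℤ)) + 1ℤ)
  split = solve-∀

-- Quivers and mutation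

μ-row : ∀ (v : Fin n) P b → μ v P v b ≡ - P v b
μ-row v P b with v ≟ v
... | yes _ = refl
... | no v≢v = ⊥-elim (v≢v refl)

μ-column : ∀ (v : Fin n) P a → μ v P a v ≡ - P a v
μ-column v P a with v ≟ a | v ≟ v
... | yes _ | _     = refl
... | no _  | yes _ = refl
... | no _  | no v≢v = ⊥-elim (v≢v refl)

μ-away : ∀ (v : Fin n) P a b → v ≢ a → v ≢ b →
         μ v P a b ≡ P a b + pos (P a v) * pos (P v b) - pos (P b v) * pos (P v a)
μ-away v P a b v≢a v≢b with v ≟ a | v ≟ b
... | yes v≡a | _     = ⊥-elim (v≢a v≡a)
... | no _    | yes v≡b = ⊥-elim (v≢b v≡b)
... | no _    | no _  = refl

pos-of-positive : ∀ {x} → 0ℤ < x → pos x ≡ x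
pos-of-positive 0<x = ℤP.i≥j⇒i⊔j≡i (ℤP.<⇒≤ 0<x)

pos-of-nonpositive : ∀ {x} → ¬ (0ℤ < x) → pos x ≡ 0ℤ
pos-of-nonpositive 0≮x = ℤP.i≤j⇒i⊔j≡j (ℤP.≮⇒≥ 0≮x)

i≡-i⇒i≡0 : ∀ {i : ℤ} → i ≡ - i → i ≡ 0ℤ
i≡-i⇒i≡0 {+ ℕ.zero} _ = refl
i≡-i⇒i≡0 {+[1+ m ]} ()
i≡-i⇒i≡0 { -[1+ m ]} ()

2≤i⇒2≤∣i∣ : ∀ {i} → + 2 ≤ i → 2 ℕ.≤ ∣ i ∣
2≤i⇒2≤∣i∣ (+≤+ 2≤m) = 2≤m

2≤∣-i∣ : ∀ {i j} → j ≡ - i → 2 ℕ.≤ ∣ i ∣ → 2 ℕ.≤ ∣ j ∣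
2≤∣-i∣ {i} refl = subst (2 ℕ.≤_) (sym (ℤP.∣-i∣≡∣i∣ i))

module _ {P : Mat n} (quiver : IsQuiver P) where

  diagonal≡0 : ∀ i → P i i ≡ 0ℤ
  diagonal≡0 i = i≡-i⇒i≡0 (quiver i i)

  negate-entry : ∀ i j → - P i j ≡ P j i
  negate-entry i j = trans (cong -_ (quiver i j)) (ℤP.neg-involutive _)

  ¬loop : ∀ i → ¬ Arrow P i i
  ¬loop i 0<Pii = ℤP.<-irrefl (sym (diagonal≡0 i)) 0<Pii

  arrow-asym : ∀ {i j} → Arrow P i j → ¬ Arrow P j i
  arrow-asym {i} {j} i→j j→i =
    ℤP.<-asym i→j (subst (_< 0ℤ) (sym (quiver i j)) (ℤP.neg-mono-< j→i))

  arrow⇒≢ : ∀ {i j} → Arrow P i j → i ≢ j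
  arrow⇒≢ i→j refl = ¬loop _ i→j

module _ {P : Mat n} (quiver : IsQuiver P) (abundant : Abundant P) where

  arrow⊎reverse : ∀ {i j} → i ≢ j → Arrow P i j ⊎ Arrow P j i
  arrow⊎reverse {i} {j} i≢j with P i j in eq | abundant i j i≢j
  ... | +[1+ m ] | _ = inj₁ (+<+ (s≤s z≤n))
  ... | -[1+ m ] | _ = inj₂ (subst (0ℤ <_) (sym (trans (quiver j i) (cong -_ eq))) (+<+ (s≤s z≤n)))

  ¬arrow⇒reverse : ∀ {i j} → i ≢ j → ¬ Arrow P i j → Arrow P j i
  ¬arrow⇒reverse i≢j ¬i→j with arrow⊎reverse i≢j
  ... | inj₁ i→j = ⊥-elim (¬i→j i→j)
  ... | inj₂ j→i = j→i

arrow≥2 : ∀ {P : Mat n} → Abundant P → ∀ {i j} → i ≢ j → Arrow P i j → + 2 ≤ P i j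
arrow≥2 {P = P} abundant {i} {j} i≢j _ with P i j | abundant i j i≢j
... | + m | 2≤m = +≤+ 2≤m

arrow? : ∀ (P : Mat n) i j → Dec (Arrow P i j)
arrow? P i j = 0ℤ ℤP.<? P i j

μ-across : ∀ {P : Mat n} → IsQuiver P → ∀ {v a b} → Arrow P a v → Arrow P v b →
           μ v P a b ≡ P a b + P a v * P v b
μ-across {P = P} quiver {v} {a} {b} a→v v→b = begin
  μ v P a b
    ≡⟨ μ-away v P a b (arrow⇒≢ quiver a→v ∘ sym) (arrow⇒≢ quiver v→b) ⟩
  P a b + pos (P a v) * pos (P v b) - pos (P b v) * pos (P v a)
    ≡⟨ cong₂ (λ s t → P a b + s - t)
             (cong₂ _*_ (pos-of-positive a→v) (pos-of-positive v→b))
             (cong (_* pos (P v a)) (pos-of-nonpositive (arrow-asym quiver v→b))) ⟩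
  P a b + P a v * P v b - 0ℤ
    ≡⟨ ℤP.+-identityʳ _ ⟩
  P a b + P a v * P v b ∎
  where open ≡-Reasoning

μ-unchanged : ∀ {P : Mat n} {v a b} → v ≢ a → v ≢ b →
              (¬ Arrow P a v ⊎ ¬ Arrow P v b) → (¬ Arrow P b v ⊎ ¬ Arrow P v a) →
              μ v P a b ≡ P a b
μ-unchanged {P = P} {v} {a} {b} v≢a v≢b no-a→v→b no-b→v→a = begin
  μ v P a b
    ≡⟨ μ-away v P a b v≢a v≢b ⟩
  P a b + pos (P a v) * pos (P v b) - pos (P b v) * pos (P v a)
    ≡⟨ cong₂ (λ s t → P a b + s - t) (no-path no-a→v→b) (no-path no-b→v→a) ⟩
  P a b + 0ℤ - 0ℤ
    ≡⟨ trans (ℤP.+-identityʳ _) (ℤP.+-identityʳ _) ⟩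
  P a b ∎
  where
  open ≡-Reasoning
  no-path : ∀ {x y} → ¬ Arrow P x v ⊎ ¬ Arrow P v y → pos (P x v) * pos (P v y) ≡ 0ℤ
  no-path (inj₁ ¬x→v) rewrite pos-of-nonpositive ¬x→v = refl
  no-path {x} (inj₂ ¬v→y) rewrite pos-of-nonpositive ¬v→y = ℤP.*-zeroʳ (pos (P x v))

μ-abundant-of-away : ∀ {P : Mat n} {v} → Abundant P →
  (∀ a b → v ≢ a → v ≢ b → a ≢ b → 2 ℕ.≤ ∣ μ v P a b ∣) → Abundant (μ v P)
μ-abundant-of-away {P = P} {v} abundant away a b a≢b with a ≟ v | b ≟ v
... | yes refl | _ = 2≤∣-i∣ (μ-row v P b) (abundant v b a≢b)
... | no _ | yes refl = 2≤∣-i∣ (μ-column v P a) (abundant a v a≢b)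
... | no a≢v | no b≢v = away a b (a≢v ∘ sym) (b≢v ∘ sym) a≢b

μ-cong : ∀ {P P′ : Mat n} (v : Fin n) → P ≈Q P′ → μ v P ≈Q μ v P′
μ-cong v P≈P′ a b with v ≟ a | v ≟ b
... | yes _ | _     = cong -_ (P≈P′ a b)
... | no _  | yes _ = cong -_ (P≈P′ a b)
... | no _  | no _  rewrite P≈P′ a b | P≈P′ a v | P≈P′ v b | P≈P′ b v | P≈P′ v a = refl

μ-isQuiver : ∀ {P : Mat n} (v : Fin n) → IsQuiver P → IsQuiver (μ v P)
μ-isQuiver {P = P} v quiver a b with v ≟ a | v ≟ b
... | yes _ | yes _ = cong -_ (quiver a b)
... | yes _ | no _  = cong -_ (quiver a b)
... | no _  | yes _ = cong -_ (quiver a b)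
... | no _  | no _  rewrite quiver a b =
  skew (P b a) (pos (P a v) * pos (P v b)) (pos (P b v) * pos (P v a))
  where
  skew : ∀ x y z → - x + y - z ≡ - (x + z - y)
  skew = solve-∀

μ-involutive : ∀ {P : Mat n} → IsQuiver P → ∀ v → μ v (μ v P) ≈Q P
μ-involutive {P = P} quiver v a b = by-cases (v ≟ a) (v ≟ b)
  where
  reverse : ∀ x y → - P x y ≡ P y x
  reverse = negate-entry quiver
  cancel : ∀ p x y x′ y′ → p + x * y - x′ * y′ + y′ * x′ - y * x ≡ p
  cancel = solve-∀
  by-cases : Dec (v ≡ a) → Dec (v ≡ b) → μ v (μ v P) a b ≡ P a b
  by-cases (yes refl) _ = trans (μ-row v (μ v P) b) (trans (cong -_ (μ-row v P b)) (ℤP.neg-involutive _))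
  by-cases (no _) (yes refl) = trans (μ-column v (μ v P) a) (trans (cong -_ (μ-column v P a)) (ℤP.neg-involutive _))
  by-cases (no v≢a) (no v≢b) = begin
    μ v (μ v P) a b
      ≡⟨ μ-away v (μ v P) a b v≢a v≢b ⟩
    μ v P a b + pos (μ v P a v) * pos (μ v P v b) - pos (μ v P b v) * pos (μ v P v a)
      ≡⟨ cong₂ (λ s t → μ v P a b + s - t)
               (cong₂ (λ s t → pos s * pos t) (trans (μ-column v P a) (reverse a v)) (trans (μ-row v P b) (reverse v b)))
               (cong₂ (λ s t → pos s * pos t) (trans (μ-column v P b) (reverse b v))
                                              (trans (μ-row v P a) (reverse v a))) ⟩
    μ v P a b + pos (P v a) * pos (P b v) - pos (P v b) * pos (P a v)
      ≡⟨ cong (λ s → s + pos (P v a) * pos (P b v) - pos (P v b) * pos (P a v)) (μ-away v P a b v≢a v≢b) ⟩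
    P a b + pos (P a v) * pos (P v b) - pos (P b v) * pos (P v a) + pos (P v a) * pos (P b v) - pos (P v b) * pos (P a v)
      ≡⟨ cancel (P a b) (pos (P a v)) (pos (P v b)) (pos (P b v)) (pos (P v a)) ⟩
    P a b ∎
      where open ≡-Reasoning

≈Q-sym : ∀ {P P′ : Mat n} → P ≈Q P′ → P′ ≈Q P
≈Q-sym P≈P′ a b = sym (P≈P′ a b)

≈Q-trans : ∀ {P P′ P″ : Mat n} → P ≈Q P′ → P′ ≈Q P″ → P ≈Q P″
≈Q-trans P≈P′ P′≈P″ a b = trans (P≈P′ a b) (P′≈P″ a b)

arrow-≈ : ∀ {P P′ : Mat n} → P ≈Q P′ → ∀ {a b} → Arrow P a b → Arrow P′ a b
arrow-≈ P≈P′ {a} {b} = subst (0ℤ <_) (P≈P′ a b)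

op : Mat n → Mat n
op P i j = - P i j

op-involutive : ∀ (P : Mat n) → op (op P) ≈Q P
op-involutive P i j = ℤP.neg-involutive (P i j)

op-isQuiver : ∀ {P : Mat n} → IsQuiver P → IsQuiver (op P)
op-isQuiver quiver i j = cong -_ (quiver i j)

op-abundant : ∀ {P : Mat n} → Abundant P → Abundant (op P)
op-abundant {P = P} abundant i j i≢j = 2≤∣-i∣ {P i j} refl (abundant i j i≢j)

module _ {P : Mat n} (quiver : IsQuiver P) where

  arrow-op : ∀ {i j} → Arrow P i j → Arrow (op P) j i
  arrow-op {i} {j} = subst (0ℤ <_) (quiver i j)

  arrow-op⁻ : ∀ {i j} → Arrow (op P) i j → Arrow P j i
  arrow-op⁻ {i} {j} = subst (0ℤ <_) (sym (quiver j i))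

  isSource-op : ∀ {v} → IsSink P v → IsSource (op P) v
  isSource-op sink j j→v = sink j (arrow-op⁻ j→v)

  isSink-op⁻ : ∀ {v} → IsSource (op P) v → IsSink P v
  isSink-op⁻ source j v→j = source j (arrow-op v→j)

  μ-op : ∀ (v : Fin n) → μ v (op P) ≈Q op (μ v P)
  μ-op v a b = by-cases (v ≟ a) (v ≟ b)
    where
    reverse : ∀ x y → - P x y ≡ P y x
    reverse = negate-entry quiver
    swap : ∀ p x y x′ y′ → - p + y′ * x′ - y * x ≡ - (p + x * y - x′ * y′)
    swap = solve-∀
    by-cases : Dec (v ≡ a) → Dec (v ≡ b) → μ v (op P) a b ≡ - μ v P a b
    by-cases (yes refl) _ = trans (μ-row v (op P) b) (cong -_ (sym (μ-row v P b)))
    by-cases (no _) (yes refl) = trans (μ-column v (op P) a) (cong -_ (sym (μ-column v P a)))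
    by-cases (no v≢a) (no v≢b) = begin
      μ v (op P) a b
        ≡⟨ μ-away v (op P) a b v≢a v≢b ⟩
      - P a b + pos (- P a v) * pos (- P v b) - pos (- P b v) * pos (- P v a)
        ≡⟨ cong₂ (λ s t → - P a b + s - t)
                 (cong₂ (λ s t → pos s * pos t) (reverse a v) (reverse v b))
                 (cong₂ (λ s t → pos s * pos t) (reverse b v) (reverse v a)) ⟩
      - P a b + pos (P v a) * pos (P b v) - pos (P v b) * pos (P a v)
        ≡⟨ swap (P a b) (pos (P a v)) (pos (P v b)) (pos (P b v)) (pos (P v a)) ⟩
      - (P a b + pos (P a v) * pos (P v b) - pos (P b v) * pos (P v a))
        ≡⟨ cong -_ (sym (μ-away v P a b v≢a v≢b)) ⟩
      - μ v P a b ∎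
      where open ≡-Reasoning

-- Acyclicity on vertex subsets

TransClosure-map : ∀ {R R′ : Fin n → Fin n → Set} → (∀ {a b} → R a b → R′ a b) →
                   ∀ {a b} → TransClosure R a b → TransClosure R′ a b
TransClosure-map f [ r ]     = [ f r ]
TransClosure-map f (r ∷ rs) = f r ∷ TransClosure-map f rs

ArrowOn : Mat n → (Fin n → Set) → Fin n → Fin n → Set
ArrowOn P S a b = S a × S b × Arrow P a b

AcyclicOn-map : ∀ {P P′ : Mat n} {S S′ : Fin n → Set} →
                (∀ {a b} → ArrowOn P′ S′ a b → ArrowOn P S a b) → AcyclicOn P S → AcyclicOn P′ S′
AcyclicOn-map {P = P} {S = S} f acyclic (i , _ , cycle) = acyclic (i , start cycle′ , cycle′)
  where
  cycle′ : TransClosure (ArrowOn P S) i i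
  cycle′ = TransClosure-map f cycle
  start : ∀ {P a b} → TransClosure (ArrowOn P S) a b → S a
  start [ (sa , _) ]     = sa
  start ((sa , _) ∷ _) = sa

AcyclicOn-⊆ : ∀ {P : Mat n} {S S′ : Fin n → Set} → (∀ {x} → S′ x → S x) → AcyclicOn P S → AcyclicOn P S′
AcyclicOn-⊆ S′⊆S = AcyclicOn-map λ (sa , sb , a→b) → S′⊆S sa , S′⊆S sb , a→b

Acyclic⇒AcyclicOn : ∀ {P : Mat n} {S : Fin n → Set} → Acyclic P → AcyclicOn P S
Acyclic⇒AcyclicOn acyclic (i , _ , cycle) = acyclic (i , TransClosure-map (proj₂ ∘′ proj₂) cycle)

AcyclicOn-everywhere⇒Acyclic : ∀ {P : Mat n} {S : Fin n → Set} → (∀ x → S x) → AcyclicOn P S → Acyclic P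
AcyclicOn-everywhere⇒Acyclic everywhere acyclic (i , cycle) =
  acyclic (i , everywhere i , TransClosure-map (λ {a} {b} a→b → everywhere a , everywhere b , a→b) cycle)

Acyclic-≈ : ∀ {P P′ : Mat n} → P ≈Q P′ → Acyclic P → Acyclic P′
Acyclic-≈ P≈P′ acyclic (i , cycle) = acyclic (i , TransClosure-map (arrow-≈ (≈Q-sym P≈P′)) cycle)

-- a path can only leave S₁ ∪ S₂ from S₁ to S₂, so every cycle stays inside S₁ or inside S₂
AcyclicOn-∪ : ∀ {P : Mat n} {S₁ S₂ : Fin n → Set} →
  AcyclicOn P S₁ → AcyclicOn P S₂ → (∀ {a b} → S₂ a → S₁ b → ¬ Arrow P a b) →
  AcyclicOn P (λ x → S₁ x ⊎ S₂ x)
AcyclicOn-∪ {P = P} {S₁} {S₂} acyclic₁ acyclic₂ no-back (i , si , cycle) = from si cycle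
  where
  S : Fin _ → Set
  S x = S₁ x ⊎ S₂ x
  stay₂ : ∀ {a b} → S₂ a → TransClosure (ArrowOn P S) a b → TransClosure (ArrowOn P S₂) a b
  stay₂ s₂a [ (_ , inj₂ s₂b , a→b) ]     = [ (s₂a , s₂b , a→b) ]
  stay₂ s₂a [ (_ , inj₁ s₁b , a→b) ]     = ⊥-elim (no-back s₂a s₁b a→b)
  stay₂ s₂a ((_ , inj₂ s₂b , a→b) ∷ rest) = (s₂a , s₂b , a→b) ∷ stay₂ s₂b rest
  stay₂ s₂a ((_ , inj₁ s₁b , a→b) ∷ _)   = ⊥-elim (no-back s₂a s₁b a→b)
  end₂ : ∀ {a b} → TransClosure (ArrowOn P S₂) a b → S₂ b
  end₂ [ (_ , s₂b , _) ]   = s₂b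
  end₂ (_ ∷ rest)        = end₂ rest
  stay₁-or-reach₂ : ∀ {a b} → S₁ a → TransClosure (ArrowOn P S) a b → TransClosure (ArrowOn P S₁) a b ⊎ S₂ b
  stay₁-or-reach₂ s₁a [ (_ , inj₁ s₁b , a→b) ] = inj₁ [ (s₁a , s₁b , a→b) ]
  stay₁-or-reach₂ s₁a [ (_ , inj₂ s₂b , _) ]   = inj₂ s₂b
  stay₁-or-reach₂ s₁a ((_ , inj₁ s₁b , a→b) ∷ rest) with stay₁-or-reach₂ s₁b rest
  ... | inj₁ path = inj₁ ((s₁a , s₁b , a→b) ∷ path)
  ... | inj₂ s₂   = inj₂ s₂
  stay₁-or-reach₂ s₁a ((_ , inj₂ s₂b , _) ∷ rest) = inj₂ (end₂ (stay₂ s₂b rest))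
  from : ∀ {i} → S i → TransClosure (ArrowOn P S) i i → ⊥
  from {i} (inj₂ s₂) cycle = acyclic₂ (i , s₂ , stay₂ s₂ cycle)
  from {i} (inj₁ s₁) cycle with stay₁-or-reach₂ s₁ cycle
  ... | inj₁ cycle₁ = acyclic₁ (i , s₁ , cycle₁)
  ... | inj₂ s₂     = acyclic₂ (i , s₂ , stay₂ s₂ cycle)

AcyclicOn-singleton : ∀ {P : Mat n} → IsQuiver P → ∀ r → AcyclicOn P (_≡ r)
AcyclicOn-singleton quiver r (_ , refl , [ (_ , refl , r→r) ])     = ¬loop quiver r r→r
AcyclicOn-singleton quiver r (_ , refl , ((_ , refl , r→r) ∷ _)) = ¬loop quiver r r→r

module _ {P : Mat n} (quiver : IsQuiver P) where

  reverse-path : ∀ {S : Fin n → Set} {a b} →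
                 TransClosure (ArrowOn (op P) S) a b → TransClosure (ArrowOn P S) b a
  reverse-path [ (sa , sb , a→b) ]          = [ (sb , sa , arrow-op⁻ quiver a→b) ]
  reverse-path ((sa , sb , a→b) ∷ rest) = reverse-path rest ∷ʳ (sb , sa , arrow-op⁻ quiver a→b)

  AcyclicOn-op : ∀ {S : Fin n → Set} → AcyclicOn P S → AcyclicOn (op P) S
  AcyclicOn-op acyclic (i , si , cycle) = acyclic (i , si , reverse-path cycle)

  Acyclic-op : Acyclic P → Acyclic (op P)
  Acyclic-op acyclic =
    AcyclicOn-everywhere⇒Acyclic {S = λ _ → ⊤} (λ _ → tt) (AcyclicOn-op (Acyclic⇒AcyclicOn acyclic))

module _ {P : Mat n} (quiver : IsQuiver P) (abundant : Abundant P) where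

  -- in an abundant quiver a missing arrow a → c is a reversed one, closing the cycle a → b → c → a
  arrow-transitiveOn : ∀ {S : Fin n → Set} → AcyclicOn P S →
    ∀ {a b c} → S a → S b → S c → Arrow P a b → Arrow P b c → Arrow P a c
  arrow-transitiveOn acyclic {a} {b} {c} sa sb sc a→b b→c with arrow? P a c | a ≟ c
  ... | yes a→c | _ = a→c
  ... | no _ | yes refl = ⊥-elim (arrow-asym quiver a→b b→c)
  ... | no ¬a→c | no a≢c = ⊥-elim (acyclic (a , sa ,
        (sa , sb , a→b) ∷ (sb , sc , b→c) ∷ [ (sc , sa , ¬arrow⇒reverse quiver abundant a≢c ¬a→c) ]))

  arrow-transitive : Acyclic P → ∀ {a b c} → Arrow P a b → Arrow P b c → Arrow P a c
  arrow-transitive acyclic = arrow-transitiveOn {S = λ _ → ⊤} (Acyclic⇒AcyclicOn acyclic) tt tt tt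

-- Forks

PointOfReturn : Mat n → Fin n → Set
PointOfReturn {n} F r =
  (∀ (i j : Fin n) → Arrow F i r → Arrow F r j → (F j i > F i r) × (F j i > F r j))
  × AcyclicOn F (λ i → Arrow F i r)
  × AcyclicOn F (λ j → Arrow F r j)

IsForkAt : Mat n → Fin n → Set
IsForkAt F r = Abundant F × ¬ Acyclic F × PointOfReturn F r

IsForkAt⇒IsFork : ∀ {F : Mat n} {r} → IsForkAt F r → IsFork F
IsForkAt⇒IsFork (abundant , cyclic , point) = abundant , cyclic , _ , point

IsForkAt-≈ : ∀ {F F′ : Mat n} {r} → F ≈Q F′ → IsForkAt F r → IsForkAt F′ r
IsForkAt-≈ {F = F} {F′} {r} F≈F′ (abundant , cyclic , dominates , acyclic⁻ , acyclic⁺) =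
  abundant′ , cyclic ∘ Acyclic-≈ (≈Q-sym F≈F′) , dominates′ ,
  AcyclicOn-map (λ (x , y , a→b) → back x , back y , back a→b) acyclic⁻ ,
  AcyclicOn-map (λ (x , y , a→b) → back x , back y , back a→b) acyclic⁺
  where
  back : ∀ {a b} → Arrow F′ a b → Arrow F a b
  back = arrow-≈ (≈Q-sym F≈F′)
  abundant′ : Abundant F′
  abundant′ a b a≢b = subst (λ z → 2 ℕ.≤ ∣ z ∣) (F≈F′ a b) (abundant a b a≢b)
  dominates′ : ∀ i j → Arrow F′ i r → Arrow F′ r j → (F′ j i > F′ i r) × (F′ j i > F′ r j)
  dominates′ i j i→r r→j with dominates i j (back i→r) (back r→j)
  ... | ineq₁ , ineq₂ rewrite F≈F′ j i | F≈F′ i r | F≈F′ r j = ineq₁ , ineq₂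

IsForkAt-op : ∀ {F : Mat n} {r} → IsQuiver F → IsForkAt F r → IsForkAt (op F) r
IsForkAt-op {F = F} {r} quiver (abundant , cyclic , dominates , acyclic⁻ , acyclic⁺) =
  op-abundant {P = F} abundant ,
  cyclic ∘ Acyclic-≈ (op-involutive F) ∘ Acyclic-op (op-isQuiver quiver) ,
  dominates′ ,
  AcyclicOn-⊆ (arrow-op⁻ quiver) (AcyclicOn-op quiver acyclic⁺) ,
  AcyclicOn-⊆ (arrow-op⁻ quiver) (AcyclicOn-op quiver acyclic⁻)
  where
  dominates′ : ∀ i j → Arrow (op F) i r → Arrow (op F) r j → (op F j i > op F i r) × (op F j i > op F r j)
  dominates′ i j i→r r→j with dominates j i (arrow-op⁻ quiver r→j) (arrow-op⁻ quiver i→r)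
  ... | ineq₁ , ineq₂ rewrite negate-entry quiver j i | negate-entry quiver i r | negate-entry quiver r j =
    ineq₂ , ineq₁

-- For j → k → i, the weight of j → i in μ k F is F j i + F j k * F k i (see μ-across);
-- these are the inequalities making k a point of return of μ k F.
DominatesAfterμ : Mat n → Fin n → Set
DominatesAfterμ {n} F k = ∀ (i j : Fin n) → Arrow F k i → Arrow F j k →
  (F k i < F j i + F j k * F k i) × (F j k < F j i + F j k * F k i)

dominatesAfterμ-of-arrow : ∀ {F : Mat n} {i j k} → Arrow F j i → Arrow F j k → Arrow F k i →
  (F k i < F j i + F j k * F k i) × (F j k < F j i + F j k * F k i)
dominatesAfterμ-of-arrow j→i j→k k→i = j<k+i*j j→i j→k k→i , i<k+i*j j→i j→k k→i

module _ {F : Mat n} {k : Fin n} (quiver : IsQuiver F) (abundant : Abundant F)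
         (dominates : DominatesAfterμ F k) where

  private
    F′ : Mat n
    F′ = μ k F

    in′≡out : ∀ i → F′ i k ≡ F k i
    in′≡out i = trans (μ-column k F i) (negate-entry quiver i k)

    out′≡in : ∀ j → F′ k j ≡ F j k
    out′≡in j = trans (μ-row k F j) (negate-entry quiver k j)

    in′⇒out : ∀ {i} → Arrow F′ i k → Arrow F k i
    in′⇒out {i} = subst (0ℤ <_) (in′≡out i)

    out′⇒in : ∀ {j} → Arrow F′ k j → Arrow F j k
    out′⇒in {j} = subst (0ℤ <_) (out′≡in j)

    out⇒in′ : ∀ {i} → Arrow F k i → Arrow F′ i k
    out⇒in′ {i} = subst (0ℤ <_) (sym (in′≡out i))

    in⇒out′ : ∀ {j} → Arrow F j k → Arrow F′ k j
    in⇒out′ {j} = subst (0ℤ <_) (sym (out′≡in j))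

    across≥2 : ∀ {a b} → a ≢ k → Arrow F a k → Arrow F k b → + 2 ≤ F′ a b
    across≥2 {a} {b} a≢k a→k k→b = subst (+ 2 ≤_) (sym (μ-across quiver a→k k→b))
      (ℤP.<⇒≤ (ℤP.≤-<-trans (arrow≥2 {P = F} abundant a≢k a→k) (proj₂ (dominates b a k→b a→k))))

  μ-abundant : Abundant F′
  μ-abundant = μ-abundant-of-away abundant away
    where
    away : ∀ a b → k ≢ a → k ≢ b → a ≢ b → 2 ℕ.≤ ∣ F′ a b ∣
    away a b k≢a k≢b a≢b = by-cases (arrow? F a k) (arrow? F k b) (arrow? F b k) (arrow? F k a)
      where
      unchanged : ¬ Arrow F a k ⊎ ¬ Arrow F k b → ¬ Arrow F b k ⊎ ¬ Arrow F k a → 2 ℕ.≤ ∣ F′ a b ∣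
      unchanged no-a→k→b no-b→k→a = subst (λ z → 2 ℕ.≤ ∣ z ∣)
        (sym (μ-unchanged k≢a k≢b no-a→k→b no-b→k→a)) (abundant a b a≢b)
      by-cases : Dec (Arrow F a k) → Dec (Arrow F k b) → Dec (Arrow F b k) → Dec (Arrow F k a) →
                 2 ℕ.≤ ∣ F′ a b ∣
      by-cases (yes a→k) (yes k→b) _ _ = 2≤i⇒2≤∣i∣ (across≥2 (k≢a ∘ sym) a→k k→b)
      by-cases _ _ (yes b→k) (yes k→a) =
        2≤∣-i∣ (μ-isQuiver k quiver a b) (2≤i⇒2≤∣i∣ (across≥2 (k≢b ∘ sym) b→k k→a))
      by-cases (no ¬a→k) _ (no ¬b→k) _ = unchanged (inj₁ ¬a→k) (inj₁ ¬b→k)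
      by-cases (no ¬a→k) _ _ (no ¬k→a) = unchanged (inj₁ ¬a→k) (inj₂ ¬k→a)
      by-cases _ (no ¬k→b) (no ¬b→k) _ = unchanged (inj₂ ¬k→b) (inj₁ ¬b→k)
      by-cases _ (no ¬k→b) _ (no ¬k→a) = unchanged (inj₂ ¬k→b) (inj₂ ¬k→a)

  μ-cyclic : ∀ {i j} → Arrow F k i → Arrow F j k → ¬ Acyclic F′
  μ-cyclic {i} {j} k→i j→k acyclic = acyclic (k , in⇒out′ j→k ∷ j→′i ∷ [ out⇒in′ k→i ])
    where
    j→′i : Arrow F′ j i
    j→′i = subst (0ℤ <_) (sym (μ-across quiver j→k k→i)) (ℤP.<-trans k→i (proj₁ (dominates i j k→i j→k)))

  μ-pointOfReturn : AcyclicOn F (Arrow F k) → AcyclicOn F (λ j → Arrow F j k) → PointOfReturn F′ k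
  μ-pointOfReturn acyclic⁺ acyclic⁻ = dominates′ ,
    AcyclicOn-map (λ (x→k , y→k , x→y) → in′⇒out x→k , in′⇒out y→k ,
      subst (0ℤ <_) (μ-unchanged (arrow⇒≢ quiver (in′⇒out x→k)) (arrow⇒≢ quiver (in′⇒out y→k))
        (inj₁ (arrow-asym quiver (in′⇒out x→k))) (inj₁ (arrow-asym quiver (in′⇒out y→k)))) x→y) acyclic⁺ ,
    AcyclicOn-map (λ (k→x , k→y , x→y) → out′⇒in k→x , out′⇒in k→y ,
      subst (0ℤ <_) (μ-unchanged (arrow⇒≢ quiver (out′⇒in k→x) ∘ sym) (arrow⇒≢ quiver (out′⇒in k→y) ∘ sym)
        (inj₂ (arrow-asym quiver (out′⇒in k→y))) (inj₂ (arrow-asym quiver (out′⇒in k→x)))) x→y) acyclic⁻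
    where
    dominates′ : ∀ i j → Arrow F′ i k → Arrow F′ k j → (F′ j i > F′ i k) × (F′ j i > F′ k j)
    dominates′ i j i→k k→j with dominates i j (in′⇒out i→k) (out′⇒in k→j)
    ... | ineq₁ , ineq₂ rewrite μ-across quiver (out′⇒in k→j) (in′⇒out i→k) | in′≡out i | out′≡in j =
      ineq₁ , ineq₂

  μ-isForkAt : AcyclicOn F (Arrow F k) → AcyclicOn F (λ j → Arrow F j k) →
               ∃ (Arrow F k) → ∃ (λ j → Arrow F j k) → IsForkAt F′ k
  μ-isForkAt acyclic⁺ acyclic⁻ (_ , k→i) (_ , j→k) =
    μ-abundant , μ-cyclic k→i j→k , μ-pointOfReturn acyclic⁺ acyclic⁻

¬∀¬⇒∃ : ∀ {R : Fin n → Set} → (∀ j → Dec (R j)) → ¬ (∀ j → ¬ R j) → ∃ R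
¬∀¬⇒∃ R? ¬∀¬ with FinP.any? R?
... | yes witness = witness
... | no ¬∃ = ⊥-elim (¬∀¬ λ j r → ¬∃ (j , r))

μ-acyclic-isForkAt : ∀ {P : Mat n} {k} → IsQuiver P → Abundant P → Acyclic P →
                     ¬ IsSource P k → ¬ IsSink P k → IsForkAt (μ k P) k
μ-acyclic-isForkAt {P = P} {k} quiver abundant acyclic ¬source ¬sink =
  μ-isForkAt quiver abundant dominates (Acyclic⇒AcyclicOn acyclic) (Acyclic⇒AcyclicOn acyclic)
    (¬∀¬⇒∃ (arrow? P k) ¬sink) (¬∀¬⇒∃ (λ j → arrow? P j k) ¬source)
  where
  dominates : DominatesAfterμ P k
  dominates i j k→i j→k = dominatesAfterμ-of-arrow {F = P}
    (arrow-transitive quiver abundant acyclic j→k k→i) j→k k→i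

module _ {F : Mat n} {r : Fin n} (quiver : IsQuiver F) (fork : IsForkAt F r) where

  private
    abundant : Abundant F
    abundant = proj₁ fork
    cyclic : ¬ Acyclic F
    cyclic = proj₁ (proj₂ fork)
    dominates : ∀ i j → Arrow F i r → Arrow F r j → (F j i > F i r) × (F j i > F r j)
    dominates = proj₁ (proj₂ (proj₂ fork))
    acyclic⁻ : AcyclicOn F (λ i → Arrow F i r)
    acyclic⁻ = proj₁ (proj₂ (proj₂ (proj₂ fork)))
    acyclic⁺ : AcyclicOn F (Arrow F r)
    acyclic⁺ = proj₂ (proj₂ (proj₂ (proj₂ fork)))

    In Out : Fin n → Set
    In x = Arrow F x r
    Out x = Arrow F r x

    in⊎out : ∀ {x} → x ≢ r → In x ⊎ Out x
    in⊎out = arrow⊎reverse quiver abundant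

    out→in : ∀ {j i} → Out j → In i → Arrow F j i
    out→in {j} {i} r→j i→r = ℤP.<-trans i→r (proj₁ (dominates i j i→r r→j))

    acyclic-out∪in : AcyclicOn F (λ x → Out x ⊎ In x)
    acyclic-out∪in = AcyclicOn-∪ acyclic⁺ acyclic⁻ (λ i→r r→j i→j → arrow-asym quiver (out→in r→j i→r) i→j)

    acyclic-r∪out : AcyclicOn F (λ x → x ≡ r ⊎ Out x)
    acyclic-r∪out = AcyclicOn-∪ (AcyclicOn-singleton quiver r) acyclic⁺
      (λ { r→j refl j→r → arrow-asym quiver r→j j→r })

    -- if every vertex were r or an out-neighbour of r, F would be acyclic
    ∃in : ∃ In
    ∃in = ¬∀¬⇒∃ (λ x → arrow? F x r) λ ¬in →
      cyclic (AcyclicOn-everywhere⇒Acyclic (r-or-out ¬in) acyclic-r∪out)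
      where
      r-or-out : (∀ x → ¬ In x) → ∀ x → x ≡ r ⊎ Out x
      r-or-out ¬in x with x ≟ r
      ... | yes x≡r = inj₁ x≡r
      ... | no x≢r with in⊎out x≢r
      ...   | inj₁ x→r = ⊥-elim (¬in x x→r)
      ...   | inj₂ r→x = inj₂ r→x

  module _ {k : Fin n} (r→k : Arrow F r k) where

    private
      shortcut-or-return : ∀ {i j} → Arrow F k i → Arrow F j k → Arrow F j i ⊎ (j ≡ r × In i)
      shortcut-or-return {i} {j} k→i j→k with i ≟ r | j ≟ r
      ... | yes refl | _ = ⊥-elim (arrow-asym quiver r→k k→i)
      ... | no i≢r | yes refl with in⊎out i≢r
      ...   | inj₁ i→r = inj₂ (refl , i→r)
      ...   | inj₂ r→i = inj₁ r→i
      shortcut-or-return {i} {j} k→i j→k | no i≢r | no j≢r with in⊎out j≢r | in⊎out i≢r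
      ...   | inj₁ j→r | _ = ⊥-elim (arrow-asym quiver (out→in r→k j→r) j→k)
      ...   | inj₂ r→j | inj₁ i→r = inj₁ (out→in r→j i→r)
      ...   | inj₂ r→j | inj₂ r→i = inj₁ (arrow-transitiveOn quiver abundant acyclic⁺ r→j r→k r→i j→k k→i)

      dominatesAfterμ : DominatesAfterμ F k
      dominatesAfterμ i j k→i j→k with shortcut-or-return k→i j→k
      ... | inj₁ j→i = dominatesAfterμ-of-arrow {F = F} j→i j→k k→i
      ... | inj₂ (refl , i→r) rewrite quiver r i =
        j<-c+i*j i→r 2≤Frk Fir<Fki , i<-c+i*j i→r 2≤Frk Fir<Fki
        where
        2≤Frk : + 2 ≤ F r k
        2≤Frk = arrow≥2 {P = F} abundant (arrow⇒≢ quiver r→k) r→k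
        Fir<Fki : F i r < F k i
        Fir<Fki = proj₁ (dominates i k i→r r→k)

    μ-out-isForkAt : IsForkAt (μ k F) k
    μ-out-isForkAt = μ-isForkAt quiver abundant dominatesAfterμ
      (AcyclicOn-⊆ out-of-k acyclic-out∪in) (AcyclicOn-⊆ into-k acyclic-r∪out)
      (proj₁ ∃in , out→in r→k (proj₂ ∃in)) (r , r→k)
      where
      out-of-k : ∀ {x} → Arrow F k x → Out x ⊎ In x
      out-of-k {x} k→x with x ≟ r
      ... | yes refl = ⊥-elim (arrow-asym quiver r→k k→x)
      ... | no x≢r with in⊎out x≢r
      ...   | inj₁ x→r = inj₂ x→r
      ...   | inj₂ r→x = inj₁ r→x
      into-k : ∀ {x} → Arrow F x k → x ≡ r ⊎ Out x
      into-k {x} x→k with x ≟ r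
      ... | yes x≡r = inj₁ x≡r
      ... | no x≢r with in⊎out x≢r
      ...   | inj₁ x→r = ⊥-elim (arrow-asym quiver (out→in r→k x→r) x→k)
      ...   | inj₂ r→x = inj₂ r→x

μ-fork-isForkAt : ∀ {F : Mat n} {r k} → IsQuiver F → IsForkAt F r → k ≢ r → IsForkAt (μ k F) k
μ-fork-isForkAt {F = F} {k = k} quiver fork k≢r with arrow⊎reverse quiver (proj₁ fork) k≢r
... | inj₂ r→k = μ-out-isForkAt quiver fork r→k
... | inj₁ k→r =
  IsForkAt-≈ (op-involutive (μ k F)) (IsForkAt-op (op-isQuiver (μ-isQuiver k quiver))
    (IsForkAt-≈ (μ-op quiver k)
      (μ-out-isForkAt (op-isQuiver quiver) (IsForkAt-op quiver fork) (arrow-op quiver k→r))))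

-- Sources and sinks

isSource? : ∀ (P : Mat n) v → Dec (IsSource P v)
isSource? P v = FinP.all? (λ j → ¬? (arrow? P j v))

isSink? : ∀ (P : Mat n) v → Dec (IsSink P v)
isSink? P v = FinP.all? (λ j → ¬? (arrow? P v j))

module _ {P : Mat n} (quiver : IsQuiver P) (abundant : Abundant P) where

  source-unique : ∀ {a b} → IsSource P a → IsSource P b → a ≡ b
  source-unique {a} {b} source-a source-b with a ≟ b
  ... | yes a≡b = a≡b
  ... | no a≢b with arrow⊎reverse quiver abundant a≢b
  ...   | inj₁ a→b = ⊥-elim (source-b a a→b)
  ...   | inj₂ b→a = ⊥-elim (source-a b b→a)


  -- the minimum of the transitive tournament
  source-exists : Acyclic P → Fin n → ∃ (IsSource P)
  source-exists acyclic v₀ with minimum v₀ (allFin _)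
    where
    minimum : ∀ x xs → Σ (Fin _) λ m → ∀ y → y ∈ x ∷ xs → ¬ Arrow P y m
    minimum x [] = x , λ { _ (here refl) → ¬loop quiver x }
    minimum x (x′ ∷ xs) with minimum x′ xs
    ... | m , minimal with arrow? P x m
    ...   | yes x→m = x , λ { _ (here refl) → ¬loop quiver x
                            ; y (there y∈) y→x → minimal y y∈ (arrow-transitive quiver abundant acyclic y→x x→m) }
    ...   | no ¬x→m = m , λ { _ (here refl) → ¬x→m ; y (there y∈) → minimal y y∈ }
  ... | m , minimal = m , λ y → minimal y (there (∈-allFin y))

sink-unique : ∀ {P : Mat n} → IsQuiver P → Abundant P → ∀ {a b} → IsSink P a → IsSink P b → a ≡ b
sink-unique {P = P} quiver abundant sink-a sink-b = source-unique (op-isQuiver quiver) (op-abundant {P = P} abundant)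
  (isSource-op quiver sink-a) (isSource-op quiver sink-b)

¬path-from-sink : ∀ {P : Mat n} {v b} → IsSink P v → ¬ TransClosure (Arrow P) v b
¬path-from-sink sink [ v→b ]     = sink _ v→b
¬path-from-sink sink (v→b ∷ _) = sink _ v→b

module _ {P : Mat n} {v : Fin n} (quiver : IsQuiver P) (source : IsSource P v) where

  μ-source-isSink : IsSink (μ v P) v
  μ-source-isSink j v→j = source j (subst (0ℤ <_) (trans (μ-row v P j) (negate-entry quiver v j)) v→j)

  μ-source-away : ∀ {a b} → v ≢ a → v ≢ b → μ v P a b ≡ P a b
  μ-source-away {a} {b} v≢a v≢b = μ-unchanged v≢a v≢b (inj₁ (source a)) (inj₁ (source b))

  μ-source-abundant : Abundant P → Abundant (μ v P)
  μ-source-abundant abundant = μ-abundant-of-away abundant λ a b v≢a v≢b a≢b →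
    subst (2 ℕ.≤_) (sym (cong ∣_∣ (μ-source-away v≢a v≢b))) (abundant a b a≢b)

  -- a cycle of μ v P cannot pass through the sink v, and away from v the arrows are those of P
  μ-source-acyclic : Acyclic P → Acyclic (μ v P)
  μ-source-acyclic acyclic (i , cycle) with i ≟ v
  ... | yes refl = ¬path-from-sink μ-source-isSink cycle
  ... | no i≢v = acyclic (i , avoid (i≢v ∘ sym) (i≢v ∘ sym) cycle)
    where
    avoid : ∀ {a b} → v ≢ a → v ≢ b → TransClosure (Arrow (μ v P)) a b → TransClosure (Arrow P) a b
    avoid v≢a v≢b [ a→b ] = [ subst (0ℤ <_) (μ-source-away v≢a v≢b) a→b ]
    avoid v≢a v≢b (_∷_ {y = y} a→y rest) with y ≟ v
    ... | yes refl = ⊥-elim (¬path-from-sink μ-source-isSink rest)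
    ... | no y≢v = subst (0ℤ <_) (μ-source-away v≢a (y≢v ∘ sym)) a→y ∷ avoid (y≢v ∘ sym) v≢b rest

-- Repeated mutation at sources

iter-isQuiver : ∀ {Q : Mat n} → IsQuiver Q → ∀ v k → IsQuiver (iter Q v k)
iter-isQuiver quiver v zero    = quiver
iter-isQuiver quiver v (suc k) = μ-isQuiver (v k) (iter-isQuiver quiver v k)

flipIf : Bool → ℤ → ℤ
flipIf true  = -_
flipIf false = λ z → z

flipIf-toggleˡ : ∀ b z → - flipIf (false xor b) z ≡ flipIf (true xor b) z
flipIf-toggleˡ true  z = ℤP.neg-involutive z
flipIf-toggleˡ false z = refl

flipIf-toggleʳ : ∀ a z → - flipIf (a xor false) z ≡ flipIf (a xor true) z
flipIf-toggleʳ true  z = ℤP.neg-involutive z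
flipIf-toggleʳ false z = refl

module SourceSequence {Q : Mat n} (quiver : IsQuiver Q) (abundant : Abundant Q)
       (v : ℕ → Fin n) (source : ∀ k → IsSource (iter Q v k) (v k)) where

  iter-abundant : ∀ k → Abundant (iter Q v k)
  iter-abundant zero    = abundant
  iter-abundant (suc k) = μ-source-abundant (iter-isQuiver quiver v k) (source k) (iter-abundant k)

  mutated : ℕ → Fin n → Bool
  mutated zero    x = false
  mutated (suc k) x = mutated k x ∨ does (v k ≟ x)

  mutated-self : ∀ k → mutated (suc k) (v k) ≡ true
  mutated-self k with v k ≟ v k
  ... | yes _ = BoolP.∨-zeroʳ (mutated k (v k))
  ... | no vk≢vk = ⊥-elim (vk≢vk refl)

  mutated-other : ∀ k {x} → v k ≢ x → mutated (suc k) x ≡ mutated k x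
  mutated-other k {x} vk≢x with v k ≟ x
  ... | yes vk≡x = ⊥-elim (vk≢x vk≡x)
  ... | no _ = BoolP.∨-identityʳ (mutated k x)

  mutated⇒index : ∀ k {x} → mutated k x ≡ true → Σ ℕ λ i → i ℕ.< k × v i ≡ x
  mutated⇒index (suc k) {x} mutated-x with v k ≟ x
  ... | yes vk≡x = k , ℕP.n<1+n k , vk≡x
  ... | no _ with mutated⇒index k (trans (sym (BoolP.∨-identityʳ (mutated k x))) mutated-x)
  ...   | i , i<k , vi≡x = i , ℕP.m<n⇒m<1+n i<k , vi≡x

  index⇒mutated : ∀ {i} k → i ℕ.< k → mutated k (v i) ≡ true
  index⇒mutated {i} (suc k) i<1+k with ℕP.m≤n⇒m<n∨m≡n (ℕP.≤-pred i<1+k)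
  ... | inj₂ refl = mutated-self k
  ... | inj₁ i<k rewrite index⇒mutated k i<k = refl

  Fresh : ℕ → Set
  Fresh k = ∀ i → i ℕ.< k → mutated i (v i) ≡ false

  fresh⇒injective : ∀ {k} → Fresh k → ∀ i j → i ℕ.< k → j ℕ.< k → v i ≡ v j → i ≡ j
  fresh⇒injective fresh i j i<k j<k vi≡vj with ℕP.<-cmp i j
  ... | tri≈ _ i≡j _ = i≡j
  ... | tri< i<j _ _ with () ← trans (sym (index⇒mutated j i<j)) (trans (cong (mutated j) vi≡vj) (fresh j j<k))
  ... | tri> _ _ j<i with () ← trans (sym (index⇒mutated i j<i)) (trans (cong (mutated i) (sym vi≡vj)) (fresh i i<k))

  -- otherwise y ↦ (an index i < k with v i = y) would inject Fin n into Fin k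
  unmutated-exists : ∀ k → k ℕ.< n → ∃ λ y → mutated k y ≡ false
  unmutated-exists k k<n with FinP.any? (λ y → mutated k y BoolP.≟ false)
  ... | yes found = found
  ... | no none = ⊥-elim (ℕP.<⇒≱ k<n (FinP.injective⇒≤ position-injective))
    where
    index : (y : Fin n) → Σ ℕ λ i → i ℕ.< k × v i ≡ y
    index y = mutated⇒index k (BoolP.¬-not (λ eq → none (y , eq)))
    position : Fin n → Fin k
    position y = fromℕ< (proj₁ (proj₂ (index y)))
    position-injective : ∀ {y z} → position y ≡ position z → y ≡ z
    position-injective {y} {z} eq = trans (sym (proj₂ (proj₂ (index y))))
      (trans (cong v (FinP.fromℕ<-injective _ _ _ _ eq)) (proj₂ (proj₂ (index z))))

  -- otherwise x, v 0, …, v (n - 1) would be n + 1 distinct vertices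
  all-mutated : Fresh n → ∀ x → mutated n x ≡ true
  all-mutated fresh x with mutated n x in mutated-x
  ... | true = refl
  ... | false = ⊥-elim (ℕP.<-irrefl refl (FinP.injective⇒≤ enumerate-injective))
    where
    enumerate : Fin (suc n) → Fin n
    enumerate fzero    = x
    enumerate (fsuc i) = v (toℕ i)
    enumerate-injective : ∀ {i j} → enumerate i ≡ enumerate j → i ≡ j
    enumerate-injective {fzero} {fzero} _ = refl
    enumerate-injective {fzero} {fsuc j} x≡vj
      with () ← trans (sym mutated-x) (trans (cong (mutated n) x≡vj) (index⇒mutated n (FinP.toℕ<n j)))
    enumerate-injective {fsuc i} {fzero} vi≡x
      with () ← trans (sym mutated-x) (trans (cong (mutated n) (sym vi≡x)) (index⇒mutated n (FinP.toℕ<n i)))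
    enumerate-injective {fsuc i} {fsuc j} vi≡vj =
      cong fsuc (FinP.toℕ-injective (fresh⇒injective fresh _ _ (FinP.toℕ<n i) (FinP.toℕ<n j) vi≡vj))

  record Invariant (k : ℕ) : Set where
    field
      entries : ∀ a b → iter Q v k a b ≡ flipIf (mutated k a xor mutated k b) (Q a b)
      fresh : Fresh k
      forward : ∀ {x y} → mutated k x ≡ true → mutated k y ≡ false → Arrow Q x y

  invariant-zero : Invariant zero
  invariant-zero = record { entries = λ _ _ → refl ; fresh = λ _ () ; forward = λ () }

  module Step {k : ℕ} (inv : Invariant k) where
    open Invariant inv

    private
      P : Mat n
      P = iter Q v k
      w : Fin n
      w = v k

    -- an unmutated y has Q w → y, hence y → w in P, contradicting that w is a source of P
    next-fresh : k ℕ.< n → mutated k w ≡ false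
    next-fresh k<n with mutated k w in mutated-w
    ... | false = refl
    ... | true with unmutated-exists k k<n
    ...   | y , unmutated-y = ⊥-elim (source k y y→w)
      where
      y→w : Arrow P y w
      y→w = subst (0ℤ <_) (sym (trans (entries y w)
              (trans (cong₂ (λ s t → flipIf (s xor t) (Q y w)) unmutated-y mutated-w) (negate-entry quiver y w))))
            (forward mutated-w unmutated-y)

    module _ (unmutated-w : mutated k w ≡ false) where

      entries-suc : ∀ a b → μ w P a b ≡ flipIf (mutated (suc k) a xor mutated (suc k) b) (Q a b)
      entries-suc a b = by-cases (w ≟ a) (w ≟ b)
        where
        open ≡-Reasoning
        by-cases : Dec (w ≡ a) → Dec (w ≡ b) → μ w P a b ≡ flipIf (mutated (suc k) a xor mutated (suc k) b) (Q a b)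
        by-cases (yes refl) (yes refl) = begin
          μ w P w w                  ≡⟨ μ-row w P w ⟩
          - P w w                    ≡⟨ cong -_ (diagonal≡0 (iter-isQuiver quiver v k) w) ⟩
          0ℤ                         ≡⟨ sym (diagonal≡0 quiver w) ⟩
          Q w w                      ≡⟨ cong (λ s → flipIf (s xor s) (Q w w)) (sym (mutated-self k)) ⟩
          flipIf (mutated (suc k) w xor mutated (suc k) w) (Q w w) ∎
        by-cases (yes refl) (no w≢b) = begin
          μ w P w b                                ≡⟨ μ-row w P b ⟩
          - P w b                                  ≡⟨ cong -_ (entries w b) ⟩
          - flipIf (mutated k w xor mutated k b) (Q w b)
            ≡⟨ cong (λ s → - flipIf (s xor mutated k b) (Q w b)) unmutated-w ⟩
          - flipIf (false xor mutated k b) (Q w b) ≡⟨ flipIf-toggleˡ (mutated k b) (Q w b) ⟩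
          flipIf (true xor mutated k b) (Q w b)
            ≡⟨ cong₂ (λ s t → flipIf (s xor t) (Q w b)) (sym (mutated-self k)) (sym (mutated-other k w≢b)) ⟩
          flipIf (mutated (suc k) w xor mutated (suc k) b) (Q w b) ∎
        by-cases (no w≢a) (yes refl) = begin
          μ w P a w                                ≡⟨ μ-column w P a ⟩
          - P a w                                  ≡⟨ cong -_ (entries a w) ⟩
          - flipIf (mutated k a xor mutated k w) (Q a w)
            ≡⟨ cong (λ s → - flipIf (mutated k a xor s) (Q a w)) unmutated-w ⟩
          - flipIf (mutated k a xor false) (Q a w) ≡⟨ flipIf-toggleʳ (mutated k a) (Q a w) ⟩
          flipIf (mutated k a xor true) (Q a w)
            ≡⟨ cong₂ (λ s t → flipIf (s xor t) (Q a w)) (sym (mutated-other k w≢a)) (sym (mutated-self k)) ⟩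
          flipIf (mutated (suc k) a xor mutated (suc k) w) (Q a w) ∎
        by-cases (no w≢a) (no w≢b) = begin
          μ w P a b                                        ≡⟨ μ-source-away (iter-isQuiver quiver v k) (source k) w≢a w≢b ⟩
          P a b                                            ≡⟨ entries a b ⟩
          flipIf (mutated k a xor mutated k b) (Q a b)
            ≡⟨ cong₂ (λ s t → flipIf (s xor t) (Q a b)) (sym (mutated-other k w≢a)) (sym (mutated-other k w≢b)) ⟩
          flipIf (mutated (suc k) a xor mutated (suc k) b) (Q a b) ∎

      -- Q y → w between unmutated vertices would survive in P and point into the source w
      forward-suc : ∀ {x y} → mutated (suc k) x ≡ true → mutated (suc k) y ≡ false → Arrow Q x y
      forward-suc {x} {y} mutated-x unmutated-y = by-cases (w ≟ y) (w ≟ x)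
        where
        by-cases : Dec (w ≡ y) → Dec (w ≡ x) → Arrow Q x y
        by-cases (yes refl) _ with () ← trans (sym (mutated-self k)) unmutated-y
        by-cases (no w≢y) (yes refl) = ¬arrow⇒reverse quiver abundant (w≢y ∘ sym) ¬y→w
          where
          ¬y→w : ¬ Arrow Q y w
          ¬y→w y→w = source k y (subst (0ℤ <_) (sym (trans (entries y w)
            (cong₂ (λ s t → flipIf (s xor t) (Q y w)) (trans (sym (mutated-other k w≢y)) unmutated-y) unmutated-w))) y→w)
        by-cases (no w≢y) (no w≢x) =
          forward (trans (sym (mutated-other k w≢x)) mutated-x) (trans (sym (mutated-other k w≢y)) unmutated-y)

    invariant-suc : k ℕ.< n → Invariant (suc k)
    invariant-suc k<n = record
      { entries = entries-suc (next-fresh k<n)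
      ; fresh   = fresh-suc
      ; forward = forward-suc (next-fresh k<n)
      }
      where
      fresh-suc : Fresh (suc k)
      fresh-suc i i<1+k with ℕP.m≤n⇒m<n∨m≡n (ℕP.≤-pred i<1+k)
      ... | inj₁ i<k  = fresh i i<k
      ... | inj₂ refl = next-fresh k<n

  invariant : ∀ k → k ℕ.≤ n → Invariant k
  invariant zero    _   = invariant-zero
  invariant (suc k) k<n = Step.invariant-suc (invariant k (ℕP.<⇒≤ k<n)) k<n

  open Invariant (invariant n ℕP.≤-refl)

  returns : iter Q v n ≈Q Q
  returns a b = trans (entries a b) (cong₂ (λ s t → flipIf (s xor t) (Q a b)) (all-mutated fresh a) (all-mutated fresh b))

  distinct : ∀ k l → k ℕ.< n → l ℕ.< n → iter Q v k ≈Q iter Q v l → k ≡ l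
  distinct k l k<n l<n Pk≈Pl = fresh⇒injective fresh k l k<n l<n
    (source-unique (iter-isQuiver quiver v k) (iter-abundant k) (source k) source-l)
    where
    source-l : IsSource (iter Q v k) (v l)
    source-l j j→vl = source l j (arrow-≈ Pk≈Pl j→vl)

iter-op : ∀ {Q : Mat n} → IsQuiver Q → ∀ v k → iter (op Q) v k ≈Q op (iter Q v k)
iter-op quiver v zero    a b = refl
iter-op quiver v (suc k) = ≈Q-trans (μ-cong (v k) (iter-op quiver v k)) (μ-op (iter-isQuiver quiver v k) (v k))

module CanonicalSources {Q : Mat n} (quiver : IsQuiver Q) (abundant : Abundant Q) (acyclic : Acyclic Q)
       (v₀ : Fin n) where

  some-source : Mat n → Fin n
  some-source P with FinP.any? (isSource? P)
  ... | yes (x , _) = x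
  ... | no _        = v₀

  some-source-isSource : ∀ {P} → ∃ (IsSource P) → IsSource P (some-source P)
  some-source-isSource {P} ∃source with FinP.any? (isSource? P)
  ... | yes (_ , source) = source
  ... | no none          = ⊥-elim (none ∃source)

  M : ℕ → Mat n
  w : ℕ → Fin n
  M zero    = Q
  M (suc k) = μ (w k) (M k)
  w k = some-source (M k)

  M-properties : ∀ k → IsQuiver (M k) × Abundant (M k) × Acyclic (M k)
  w-isSource : ∀ k → IsSource (M k) (w k)
  M-properties zero = quiver , abundant , acyclic
  M-properties (suc k) with M-properties k
  ... | quiver′ , abundant′ , acyclic′ =
    μ-isQuiver (w k) quiver′ , μ-source-abundant quiver′ (w-isSource k) abundant′ ,
    μ-source-acyclic quiver′ (w-isSource k) acyclic′
  w-isSource k with M-properties k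
  ... | quiver′ , abundant′ , acyclic′ = some-source-isSource (source-exists quiver′ abundant′ acyclic′ v₀)

  M-isQuiver : ∀ k → IsQuiver (M k)
  M-isQuiver k = proj₁ (M-properties k)

  M-abundant : ∀ k → Abundant (M k)
  M-abundant k = proj₁ (proj₂ (M-properties k))

  M-acyclic : ∀ k → Acyclic (M k)
  M-acyclic k = proj₂ (proj₂ (M-properties k))

  iter≡M : ∀ k → iter Q w k ≡ M k
  iter≡M zero    = refl
  iter≡M (suc k) = cong (μ (w k)) (iter≡M k)

  iter-w-isSource : ∀ k → IsSource (iter Q w k) (w k)
  iter-w-isSource k = subst (λ P → IsSource P (w k)) (sym (iter≡M k)) (w-isSource k)

  open SourceSequence quiver abundant w iter-w-isSource

  M-returns : M n ≈Q Q
  M-returns = subst (_≈Q Q) (iter≡M n) returns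

  M-distinct : ∀ k l → k ℕ.< n → l ℕ.< n → M k ≈Q M l → k ≡ l
  M-distinct k l k<n l<n Mk≈Ml = distinct k l k<n l<n (subst₂ _≈Q_ (sym (iter≡M k)) (sym (iter≡M l)) Mk≈Ml)

  source-cycle : NCycleVia IsSource Q
  source-cycle = (w , iter-w-isSource) , λ v source →
    SourceSequence.returns quiver abundant v source , SourceSequence.distinct quiver abundant v source

sink-cycle : ∀ {Q : Mat n} → IsQuiver Q → Abundant Q → Acyclic Q → Fin n → NCycleVia IsSink Q
sink-cycle {n} {Q} quiver abundant acyclic v₀ with
  CanonicalSources.source-cycle (op-isQuiver quiver) (op-abundant {P = Q} abundant) (Acyclic-op quiver acyclic) v₀
... | (w , sources) , cycle = (w , λ k → from-op w k (sources k)) , returns-distinct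
  where
  from-op : ∀ v k → IsSource (iter (op Q) v k) (v k) → IsSink (iter Q v k) (v k)
  from-op v k source =
    isSink-op⁻ (iter-isQuiver quiver v k) λ j j→v → source j (arrow-≈ (≈Q-sym (iter-op quiver v k)) j→v)
  to-op : ∀ v k → IsSink (iter Q v k) (v k) → IsSource (iter (op Q) v k) (v k)
  to-op v k sink j j→v = isSource-op (iter-isQuiver quiver v k) sink j (arrow-≈ (iter-op quiver v k) j→v)
  returns-distinct : ∀ (v : ℕ → Fin n) → (∀ k → IsSink (iter Q v k) (v k)) →
    (iter Q v n ≈Q Q) × (∀ (k l : ℕ) → k ℕ.< n → l ℕ.< n → iter Q v k ≈Q iter Q v l → k ≡ l)
  returns-distinct v sinks with cycle v (λ k → to-op v k (sinks k))
  ... | returns , distinct =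
    (λ a b → ℤP.neg-injective (trans (sym (iter-op quiver v n a b)) (returns a b))) ,
    λ k l k<n l<n Pk≈Pl → distinct k l k<n l<n
      (≈Q-trans (iter-op quiver v k) (≈Q-trans (λ a b → cong -_ (Pk≈Pl a b)) (≈Q-sym (iter-op quiver v l))))

-- The non-forks of the mutation class

module Classification {m : ℕ} {Q : Mat (suc m)} (quiver : IsQuiver Q) (abundant : Abundant Q) (acyclic : Acyclic Q) where

  open CanonicalSources quiver abundant acyclic fzero

  data Classified : Mat (suc m) → Set where
    acyclic-member : ∀ {P} i → i ℕ.< suc m → P ≈Q M i → Classified P
    fork-member    : ∀ {P} r → IsForkAt P r → Classified (μ r P) → Classified P

  Classified-≈ : ∀ {P P′} → P ≈Q P′ → Classified P → Classified P′
  Classified-≈ P≈P′ (acyclic-member i i<n P≈Mi) = acyclic-member i i<n (≈Q-trans (≈Q-sym P≈P′) P≈Mi)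
  Classified-≈ P≈P′ (fork-member r fork rest) =
    fork-member r (IsForkAt-≈ P≈P′ fork) (Classified-≈ (μ-cong r P≈P′) rest)

  μ-source-M : ∀ {P v} i → i ℕ.< suc m → P ≈Q M i → IsSource (M i) v → Classified (μ v P)
  μ-source-M {v = v} i i<n P≈Mi source with source-unique (M-isQuiver i) (M-abundant i) source (w-isSource i)
  ... | refl with ℕP.m≤n⇒m<n∨m≡n i<n
  ...   | inj₁ 1+i<n = acyclic-member (suc i) 1+i<n (μ-cong v P≈Mi)
  ...   | inj₂ refl  = acyclic-member 0 (s≤s z≤n) (≈Q-trans (μ-cong v P≈Mi) M-returns)

  -- the sink of M (i + 1) is w i, and M 0 ≈ M (m + 1)
  μ-sink-M : ∀ {P v} i → i ℕ.< suc m → P ≈Q M i → IsSink (M i) v → Classified (μ v P)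
  μ-sink-M {v = v} zero _ P≈M0 sink
    with sink-unique (M-isQuiver 0) (M-abundant 0) sink
           (λ j → μ-source-isSink (M-isQuiver m) (w-isSource m) j ∘ arrow-≈ (≈Q-sym M-returns))
  ... | refl = acyclic-member m (ℕP.n<1+n m)
    (≈Q-trans (μ-cong v (≈Q-trans P≈M0 (≈Q-sym M-returns))) (μ-involutive (M-isQuiver m) v))
  μ-sink-M {v = v} (suc i) i<n P≈Mi sink
    with sink-unique (M-isQuiver (suc i)) (M-abundant (suc i)) sink (μ-source-isSink (M-isQuiver i) (w-isSource i))
  ... | refl = acyclic-member i (ℕP.<-trans (ℕP.n<1+n i) i<n) (≈Q-trans (μ-cong v P≈Mi) (μ-involutive (M-isQuiver i) v))

  μ-classified : ∀ {P} → IsQuiver P → Classified P → ∀ v → Classified (μ v P)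
  μ-classified quiver′ (acyclic-member i i<n P≈Mi) v with isSource? (M i) v | isSink? (M i) v
  ... | yes source | _ = μ-source-M i i<n P≈Mi source
  ... | no _ | yes sink = μ-sink-M i i<n P≈Mi sink
  ... | no ¬source | no ¬sink =
    fork-member v
      (IsForkAt-≈ (μ-cong v (≈Q-sym P≈Mi)) (μ-acyclic-isForkAt (M-isQuiver i) (M-abundant i) (M-acyclic i) ¬source ¬sink))
      (Classified-≈ (≈Q-sym (μ-involutive quiver′ v)) (acyclic-member i i<n P≈Mi))
  μ-classified quiver′ (fork-member r fork rest) v with v ≟ r
  ... | yes refl = rest
  ... | no v≢r = fork-member v (μ-fork-isForkAt quiver′ fork v≢r)
      (Classified-≈ (≈Q-sym (μ-involutive quiver′ v)) (fork-member r fork rest))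

  inClass⇒classified : ∀ {P} → InClass Q P → IsQuiver P × Classified P
  inClass⇒classified here = quiver , acyclic-member 0 (s≤s z≤n) (λ _ _ → refl)
  inClass⇒classified (step v P∈) with inClass⇒classified P∈
  ... | quiver′ , classified = μ-isQuiver v quiver′ , μ-classified quiver′ classified v

  M-inClass : ∀ k → InClass Q (M k)
  M-inClass zero    = here
  M-inClass (suc k) = step (w k) (M-inClass k)

  non-forks : Σ (Fin (suc m) → Mat (suc m)) λ L →
        (∀ (i : Fin (suc m)) → InClass Q (L i) × ¬ IsFork (L i))
        × (∀ (i j : Fin (suc m)) → L i ≈Q L j → i ≡ j)
        × (∀ (P : Mat (suc m)) → InClass Q P → ¬ IsFork P → Σ (Fin (suc m)) λ i → P ≈Q L i)
  non-forks = M ∘ toℕ ,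
    (λ i → M-inClass (toℕ i) , λ fork → proj₁ (proj₂ fork) (M-acyclic (toℕ i))) ,
    (λ i j Mi≈Mj → FinP.toℕ-injective (M-distinct (toℕ i) (toℕ j) (FinP.toℕ<n i) (FinP.toℕ<n j) Mi≈Mj)) ,
    λ P P∈ ¬fork → classify (proj₂ (inClass⇒classified P∈)) ¬fork
    where
    classify : ∀ {P} → Classified P → ¬ IsFork P → Σ (Fin (suc m)) λ i → P ≈Q M (toℕ i)
    classify {P} (acyclic-member i i<n P≈Mi) _ =
      fromℕ< i<n , subst (λ k → P ≈Q M k) (sym (FinP.toℕ-fromℕ< i<n)) P≈Mi
    classify (fork-member r fork _) ¬fork = ⊥-elim (¬fork (IsForkAt⇒IsFork fork))

lemma2p15 : ∀ (n : ℕ) → .{{_ : NonZero n}} → (Q : Mat n) → IsQuiver Q → Abundant Q → Acyclic Q →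
    (Σ (Fin n → Mat n) λ L →
        (∀ (i : Fin n) → InClass Q (L i) × ¬ IsFork (L i))
        × (∀ (i j : Fin n) → L i ≈Q L j → i ≡ j)
        × (∀ (P : Mat n) → InClass Q P → ¬ IsFork P → Σ (Fin n) λ i → P ≈Q L i))
    × NCycleVia IsSource Q
    × NCycleVia IsSink Q
lemma2p15 zero    Q quiver abundant acyclic = ⊥-elim (ℕ.≢-nonZero⁻¹ zero refl)
lemma2p15 (suc m) Q quiver abundant acyclic =
  Classification.non-forks quiver abundant acyclic ,
  CanonicalSources.source-cycle quiver abundant acyclic fzero ,
  sink-cycle quiver abundant acyclic fzero
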